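{- Let $I=\{0,1\}\times\mathbb{N}$, let $\mathfrak{G}$ be the group of all permutations $\pi$ of $I$ with $\pi(\xi)=\xi$ for all $\xi\in\{1\}\times\mathbb{N}$, and let $\Sigma_3=\Sigma(I,\mathfrak{G},{\cal I}_0^I)$. Then $\Sigma_3\models AC^{1,1}$.
   Context: The metatheory is ZFC. An $n$-ary predicate on $I$ is a map $\alpha:I^n\to\{true,false\}$ with extension $\widetilde\alpha\subseteq I^n$. Permutations act on predicates by $(\pi\alpha)(\pi\xi_1,\dots,\pi\xi_n)=\alpha(\xi_1,\dots,\xi_n)$; ${\rm sym}_\mathfrak{G}(\alpha)=\{\pi\in\mathfrak{G}\mid\pi\alpha=\alpha\}$; $\mathfrak{G}(P)$ is the pointwise stabilizer in $\mathfrak{G}$ of $P\subseteq I$. ${\cal I}_0^I$ is the ideal of finite subsets of $I$. $\Sigma(I,\mathfrak{G},{\cal I}_0^I)=(J_n)_{n\ge0}$ is the second-order Henkin(–Asser) structure with individual domain $J_0=I$ in which $n$-ary predicate variables range over $J_n=$ the set of $n$-ary predicates $\alpha$ with ${\rm sym}_\mathfrak{G}(\alpha)\supseteq\mathfrak{G}(P)$ for some finite $P\subseteq I$. $AC^{1,1}=\forall A\forall R\exists S(\forall x(Ax\leftrightarrow\exists yRxy)\to\forall x(Ax\to\exists!!y(Rxy\land Sxy)))$ with $A$ unary, $R,S$ binary, and $\exists!!$ meaning "there exists exactly one". -}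

module Defs where

open import Data.Nat using (ℕ)
open import Data.Fin using (Fin; zero; suc)
open import Data.Bool using (Bool; true; false)
open import Data.Product using (Σ; ∃; ∃-syntax; _×_; _,_; proj₁)
open import Data.List using (List)
open import Data.List.Membership.Propositional using (_∈_)
open import Data.Vec using (Vec; []; _∷_; map)
open import Function.Bundles using (_↔_; Inverse; _⇔_)
open import Relation.Binary.PropositionalEquality using (_≡_)

I : Set
I = Fin 2 × ℕ

Perm : Set
Perm = I ↔ I

inG : Perm → Set
inG π = ∀ (n : ℕ) → Inverse.to π (suc zero , n) ≡ (suc zero , n)

Pred : ℕ → Set
Pred n = Vec I n → Bool

-- Action of permutations on predicates: (πα)(πξ₁,…,πξₙ) = α(ξ₁,…,ξₙ),
-- i.e. (πα)(w) = α(π⁻¹ w).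
act : ∀ {n} → Perm → Pred n → Pred n
act π α w = α (map (Inverse.from π) w)

inStab : List I → Perm → Set
inStab P π = inG π × (∀ ξ → ξ ∈ P → Inverse.to π ξ ≡ ξ)

fixesPred : ∀ {n} → Perm → Pred n → Set
fixesPred π α = ∀ w → act π α w ≡ α w

-- J_n of Σ(I, 𝔊, 𝓘₀): predicates with sym_𝔊(α) ⊇ 𝔊(P) for some finite P ⊆ I
-- (finite subsets represented by lists).
J : ℕ → Set
J n = Σ (Pred n) λ α → ∃[ P ] (∀ π → inStab P π → fixesPred π α)

holds1 : J 1 → I → Set
holds1 A x = proj₁ A (x ∷ []) ≡ true

holds2 : J 2 → I → I → Set
holds2 R x y = proj₁ R (x ∷ y ∷ []) ≡ true

Σ₃⊨AC11 : Set
Σ₃⊨AC11 =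
  ∀ (A : J 1) (R : J 2) → ∃[ S ]
    ((∀ x → holds1 A x ⇔ (∃[ y ] holds2 R x y)) →
     ∀ x → holds1 A x →
       ∃[ y ] ((holds2 R x y × holds2 S x y) ×
               (∀ y′ → holds2 R x y′ × holds2 S x y′ → y′ ≡ y)))

-- Let ρ be supported by the finite set P, and let C be P together with two further points
-- a ≠ b of {0} × ℕ.  Put S(x, y) iff y is the first ρ(x, ·)-witness in the list x, a, b, P
-- or, if there is none, y = (1, n) with n least such that ρ(x, (1, n)).  All ingredients are
-- fixed by 𝔊(C), so C supports S.  If ρ(x, ·) has no witness among x, a, b, P, then it has
-- none in {0} × ℕ either: for (0, j) ∉ P ∪ {x} and c ∈ {a, b} ∖ {x}, the transposition of
-- (0, j) and c fixes P, x and {1} × ℕ, so ρ(x, (0, j)) = ρ(x, c) fails.  Hence the witness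
-- lies in {1} × ℕ and the least one is selected.

module Submission where

open import Defs
open import Data.Bool using (Bool; true; false; not; _∧_)
open import Data.Bool.Properties using (∧-conicalˡ; ∧-conicalʳ; T-≡)
open import Data.Fin using (zero; suc)
import Data.Fin.Properties as Fin
open import Data.List using (List; []; _∷_; map; findᵇ)
open import Data.List.Extrema.Nat using (max; xs≤max)
open import Data.List.Membership.Propositional using (_∈_; _∉_)
open import Data.List.Properties using (map-id-local)
open import Data.List.Relation.Binary.Subset.Propositional using (_⊆_)
open import Data.List.Relation.Unary.All as All using (All)
import Data.List.Relation.Unary.All.Properties as All
open import Data.List.Relation.Unary.Any using (here; there)
open import Data.Maybe as Maybe using (Maybe; just; nothing)
open import Data.Nat using (ℕ; zero; suc; _<_; _≤_)
import Data.Nat.Properties as ℕ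
open import Data.Product using (∃-syntax; _×_; _,_; proj₂)
open import Data.Product.Properties using (≡-dec)
open import Data.Sum using (_⊎_; inj₁; inj₂)
open import Data.Vec using ([]; _∷_)
open import Function using (_∘_)
open import Function.Bundles using (Inverse; Injection; Equivalence; mk↔ₛ′; mk⇔; _↔_)
open import Function.Definitions using (Injective)
open import Function.Properties.Inverse using (↔⇒↣; ↔-sym)
open import Relation.Binary.Definitions using (DecidableEquality; tri<; tri≈; tri>)
open import Relation.Binary.PropositionalEquality hiding (J)
open import Relation.Nullary using (yes; no; does; contradiction)
open import Relation.Nullary.Decidable using (dec-true; does-⇔; isYes≗does; toWitness)

noneBelow : (ℕ → Bool) → ℕ → Bool
noneBelow f zero    = true
noneBelow f (suc n) = noneBelow f n ∧ not (f n)

isLeast : (ℕ → Bool) → ℕ → Bool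
isLeast f n = f n ∧ noneBelow f n

noneBelow-cong : ∀ {f g} → (∀ m → f m ≡ g m) → ∀ n → noneBelow f n ≡ noneBelow g n
noneBelow-cong f≗g zero    = refl
noneBelow-cong f≗g (suc n) = cong₂ (λ u v → u ∧ not v) (noneBelow-cong f≗g n) (f≗g n)

isLeast-cong : ∀ {f g} → (∀ m → f m ≡ g m) → ∀ n → isLeast f n ≡ isLeast g n
isLeast-cong f≗g n = cong₂ _∧_ (f≗g n) (noneBelow-cong f≗g n)

noneBelow-sound : ∀ f {m n} → noneBelow f n ≡ true → m < n → f m ≢ true
noneBelow-sound f {m} {suc n} none m<1+n fm with ℕ.m<1+n⇒m<n∨m≡n m<1+n
... | inj₁ m<n  = noneBelow-sound f (∧-conicalˡ _ _ none) m<n fm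
... | inj₂ refl rewrite fm with () ← ∧-conicalʳ (noneBelow f m) false none

isLeast-unique : ∀ f {m n} → isLeast f m ≡ true → isLeast f n ≡ true → m ≡ n
isLeast-unique f {m} {n} least-m least-n with ℕ.<-cmp m n
... | tri< m<n _ _ =
  contradiction (∧-conicalˡ _ _ least-m) (noneBelow-sound f (∧-conicalʳ _ _ least-n) m<n)
... | tri≈ _ m≡n _ = m≡n
... | tri> _ _ n<m =
  contradiction (∧-conicalˡ _ _ least-n) (noneBelow-sound f (∧-conicalʳ _ _ least-m) n<m)

least-or-noneBelow : ∀ f n → (∃[ m ] isLeast f m ≡ true) ⊎ noneBelow f n ≡ true
least-or-noneBelow f zero = inj₂ refl
least-or-noneBelow f (suc n) with least-or-noneBelow f n
... | inj₁ least = inj₁ least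
... | inj₂ none with f n in fn
...   | true  = inj₁ (n , cong₂ _∧_ fn none)
...   | false = inj₂ (cong (_∧ true) none)

least-exists : ∀ f {n} → f n ≡ true → ∃[ m ] isLeast f m ≡ true
least-exists f {n} fn with least-or-noneBelow f (suc n)
... | inj₁ least = least
... | inj₂ none  = contradiction fn (noneBelow-sound f none (ℕ.n<1+n n))

module _ {A B : Set} where

  findᵇ-map : ∀ {p : A → Bool} {q : B → Bool} (f : A → B) → (∀ x → q (f x) ≡ p x) →
              ∀ xs → findᵇ q (map f xs) ≡ Maybe.map f (findᵇ p xs)
  findᵇ-map         f q∘f≗p []       = refl
  findᵇ-map {p = p} f q∘f≗p (x ∷ xs) rewrite q∘f≗p x with p x
  ... | true  = refl
  ... | false = findᵇ-map f q∘f≗p xs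

module _ {A : Set} where

  findᵇ-just : ∀ (p : A → Bool) xs {x} → findᵇ p xs ≡ just x → p x ≡ true
  findᵇ-just p (y ∷ xs) found with p y in py
  findᵇ-just p (y ∷ xs) refl  | true  = py
  findᵇ-just p (y ∷ xs) found | false = findᵇ-just p xs found

  findᵇ-nothing : ∀ (p : A → Bool) xs {x} → findᵇ p xs ≡ nothing → p x ≡ true → x ∉ xs
  findᵇ-nothing p (y ∷ xs) none px x∈ with p y in py
  findᵇ-nothing p (y ∷ xs) ()   px x∈          | true
  findᵇ-nothing p (y ∷ xs) none px (here refl) | false = contradiction (trans (sym px) py) λ ()
  findᵇ-nothing p (y ∷ xs) none px (there x∈)  | false = findᵇ-nothing p xs none px x∈

module Transposition {A : Set} (_≟_ : DecidableEquality A) where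

  transpose : A → A → A → A
  transpose a b z with z ≟ a | z ≟ b
  ... | yes _ | _     = b
  ... | no _  | yes _ = a
  ... | no _  | no _  = z

  module _ {a b : A} where

    transpose-left : transpose a b a ≡ b
    transpose-left with a ≟ a | a ≟ b
    ... | yes _   | _     = refl
    ... | no a≢a  | _     = contradiction refl a≢a

    transpose-right : transpose a b b ≡ a
    transpose-right with b ≟ a | b ≟ b
    ... | yes b≡a | _      = b≡a
    ... | no _    | yes _  = refl
    ... | no _    | no b≢b = contradiction refl b≢b

    transpose-other : ∀ {z} → z ≢ a → z ≢ b → transpose a b z ≡ z
    transpose-other {z} z≢a z≢b with z ≟ a | z ≟ b
    ... | yes z≡a | _       = contradiction z≡a z≢a
    ... | no _    | yes z≡b = contradiction z≡b z≢b
    ... | no _    | no _    = refl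

    transpose-involutive : ∀ z → transpose a b (transpose a b z) ≡ z
    transpose-involutive z with z ≟ a | z ≟ b
    ... | yes refl | _        = transpose-right
    ... | no _     | yes refl = transpose-left
    ... | no z≢a   | no z≢b   = transpose-other z≢a z≢b

  transposition : A → A → A ↔ A
  transposition a b =
    mk↔ₛ′ (transpose a b) (transpose a b) transpose-involutive transpose-involutive

_≟I_ : DecidableEquality I
_≟I_ = ≡-dec Fin._≟_ ℕ._≟_

open Transposition _≟I_

fixed movable : ℕ → I
fixed   n = (suc zero , n)
movable k = (zero , k)

fresh : List I → ℕ
fresh P = suc (max 0 (map proj₂ P))

fresh-∉ : ∀ P {i k} → fresh P ≤ k → (i , k) ∉ P
fresh-∉ P fresh≤k i,k∈P =
  ℕ.<⇒≱ fresh≤k (All.lookup (All.map⁻ (xs≤max 0 (map proj₂ P))) i,k∈P)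

Supports : ∀ {n} → List I → Pred n → Set
Supports P α = ∀ π → inStab P π → fixesPred π α

inStab-⊆ : ∀ {P C π} → P ⊆ C → inStab C π → inStab P π
inStab-⊆ P⊆C (π∈𝔊 , π-fixes-C) = π∈𝔊 , λ ξ ξ∈P → π-fixes-C ξ (P⊆C ξ∈P)

transposition-inStab : ∀ {P k l} → movable k ∉ P → movable l ∉ P →
                       inStab P (transposition (movable k) (movable l))
transposition-inStab {k = k} {l} k∉P l∉P =
  (λ n → transpose-other {movable k} {movable l} (λ ()) (λ ())) ,
  (λ ξ ξ∈P → transpose-other (λ { refl → k∉P ξ∈P }) (λ { refl → l∉P ξ∈P }))

row : Pred 2 → I → I → Bool
row ρ x y = ρ (x ∷ y ∷ [])

supported-row-transpose : ∀ {P ρ k l x} → Supports P ρ → movable k ∉ P → movable l ∉ P →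
                          x ≢ movable k → x ≢ movable l →
                          row ρ x (movable k) ≡ row ρ x (movable l)
supported-row-transpose {ρ = ρ} {k} {l} {x} ρ-supported k∉P l∉P x≢k x≢l = begin
  row ρ x (movable k)          ≡⟨ cong₂ (row ρ) (sym (transpose-other x≢k x≢l)) (sym transpose-right) ⟩
  row ρ (τ x) (τ (movable l))  ≡⟨ ρ-supported π (transposition-inStab k∉P l∉P) (x ∷ movable l ∷ []) ⟩
  row ρ x (movable l)          ∎
  where
  open ≡-Reasoning
  π = transposition (movable k) (movable l)
  τ = transpose (movable k) (movable l)

leastFixed : (I → Bool) → I → Bool
leastFixed r (zero     , _) = false
leastFixed r (suc zero , n) = isLeast (r ∘ fixed) n

select : Maybe I → (I → Bool) → I → Bool
select (just p) r y = does (y ≟I p)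
select nothing  r y = leastFixed r y

choose : Pred 2 → List I → Pred 2
choose ρ C (x ∷ y ∷ []) = select (findᵇ (row ρ x) (x ∷ C)) (row ρ x) y

module _ {σ : I → I} (σ-injective : Injective _≡_ _≡_ σ) (σ-fixed : ∀ n → σ (fixed n) ≡ fixed n)
         {r r′ : I → Bool} (r′∘σ≗r : ∀ z → r′ (σ z) ≡ r z) where

  leastFixed-invariant : ∀ y → leastFixed r′ (σ y) ≡ leastFixed r y
  leastFixed-invariant (suc zero , n) rewrite σ-fixed n =
    isLeast-cong (λ m → trans (cong r′ (sym (σ-fixed m))) (r′∘σ≗r (fixed m))) n
  leastFixed-invariant (zero , k) with σ (zero , k) in σk
  ... | zero     , _ = refl
  ... | suc zero , n with () ← σ-injective (trans σk (sym (σ-fixed n)))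

  select-invariant : ∀ m y → select (Maybe.map σ m) r′ (σ y) ≡ select m r y
  select-invariant (just p) y = does-⇔ (mk⇔ σ-injective (cong σ)) (σ y ≟I σ p) (y ≟I p)
  select-invariant nothing  y = leastFixed-invariant y

choose-supported : ∀ {P ρ C} → Supports P ρ → P ⊆ C → Supports C (choose ρ C)
choose-supported {P} {ρ} {C} ρ-supported P⊆C π π∈𝔊[C]@(π∈𝔊 , π-fixes-C) (x ∷ y ∷ []) = begin
  select (findᵇ r′ (σ x ∷ C)) r′ (σ y)
    ≡⟨ cong (λ D → select (findᵇ r′ (σ x ∷ D)) r′ (σ y)) (sym (map-id-local σ-fixes-C)) ⟩
  select (findᵇ r′ (map σ (x ∷ C))) r′ (σ y)
    ≡⟨ cong (λ m → select m r′ (σ y)) (findᵇ-map {q = r′} σ r′∘σ≗r (x ∷ C)) ⟩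
  select (Maybe.map σ (findᵇ r (x ∷ C))) r′ (σ y)
    ≡⟨ select-invariant σ-injective σ-fixed r′∘σ≗r (findᵇ r (x ∷ C)) y ⟩
  select (findᵇ r (x ∷ C)) r y
    ∎
  where
  open ≡-Reasoning
  σ = Inverse.from π
  r = row ρ x
  r′ = row ρ (σ x)
  from-fixes : ∀ {z} → Inverse.to π z ≡ z → σ z ≡ z
  from-fixes e = Inverse.inverseʳ π (sym e)
  σ-fixed : ∀ n → σ (fixed n) ≡ fixed n
  σ-fixed n = from-fixes (π∈𝔊 n)
  σ-fixes-C : All (λ z → σ z ≡ z) C
  σ-fixes-C = All.tabulate (λ {z} z∈C → from-fixes (π-fixes-C z z∈C))
  σ-injective : Injective _≡_ _≡_ σ
  σ-injective = Injection.injective (↔⇒↣ (↔-sym π))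
  r′∘σ≗r : ∀ z → r′ (σ z) ≡ r z
  r′∘σ≗r z = ρ-supported π (inStab-⊆ {P} {C} {π} P⊆C π∈𝔊[C]) (x ∷ z ∷ [])

ExactlyOne : (I → Bool) → (I → Bool) → Set
ExactlyOne r s = ∃[ y ] ((r y ≡ true × s y ≡ true) × (∀ y′ → r y′ ≡ true × s y′ ≡ true → y′ ≡ y))

select-just : ∀ {r p} → r p ≡ true → ExactlyOne r (select (just p) r)
select-just {p = p} rp =
  p , (rp , dec-true (p ≟I p) refl) ,
  λ y′ (_ , y′≟p) → toWitness (Equivalence.from T-≡ (trans (isYes≗does (y′ ≟I p)) y′≟p))

leastFixed-exactlyOne : ∀ {r n} → r (fixed n) ≡ true → ExactlyOne r (leastFixed r)
leastFixed-exactlyOne {r} rn with least-exists (r ∘ fixed) rn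
... | m , least = fixed m , (∧-conicalˡ _ _ least , least) , unique
  where
  unique : ∀ y′ → r y′ ≡ true × leastFixed r y′ ≡ true → y′ ≡ fixed m
  unique (suc zero , m′) (_ , least′) = cong fixed (isLeast-unique (r ∘ fixed) least′ least)

module _ {ρ : Pred 2} {P : List I} (ρ-supported : Supports P ρ)
         {k l : ℕ} (k≢l : k ≢ l) (k∉P : movable k ∉ P) (l∉P : movable l ∉ P) where

  private
    C : List I
    C = movable k ∷ movable l ∷ P

    fresh-other-than : ∀ x → ∃[ c ] movable c ∈ C × movable c ∉ P × x ≢ movable c
    fresh-other-than x with x ≟I movable k
    ... | yes refl = l , there (here refl) , l∉P , k≢l ∘ cong proj₂
    ... | no x≢k   = k , here refl , k∉P , x≢k

  fixed-witness : ∀ x {y} → row ρ x y ≡ true → findᵇ (row ρ x) (x ∷ C) ≡ nothing →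
                  ∃[ n ] row ρ x (fixed n) ≡ true
  fixed-witness x {suc zero , n} rxy _    = n , rxy
  fixed-witness x {zero     , j} rxy none with fresh-other-than x
  ... | c , c∈C , c∉P , x≢c =
    contradiction (there c∈C)
                  (absent (trans (supported-row-transpose ρ-supported c∉P j∉P x≢c x≢j) rxy))
    where
    absent : ∀ {z} → row ρ x z ≡ true → z ∉ x ∷ C
    absent = findᵇ-nothing (row ρ x) (x ∷ C) none
    j∉P : movable j ∉ P
    j∉P = absent rxy ∘ there ∘ there ∘ there
    x≢j : x ≢ movable j
    x≢j x≡j = absent rxy (here (sym x≡j))

  choose-exactlyOne : ∀ x {y} → row ρ x y ≡ true → ExactlyOne (row ρ x) (row (choose ρ C) x)
  choose-exactlyOne x rxy with findᵇ (row ρ x) (x ∷ C) in found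
  ... | just p  = select-just (findᵇ-just (row ρ x) (x ∷ C) found)
  ... | nothing = leastFixed-exactlyOne (proj₂ (fixed-witness x rxy found))

proposition2p14 : Σ₃⊨AC11
proposition2p14 _ (ρ , P , ρ-supported) =
  (choose ρ C , C , choose-supported ρ-supported (there ∘ there)) ,
  λ A⇔dom x Ax →
    choose-exactlyOne ρ-supported k≢l k∉P l∉P x (proj₂ (Equivalence.to (A⇔dom x) Ax))
  where
  k = fresh P
  l = suc k
  C = movable k ∷ movable l ∷ P
  k≢l : k ≢ l
  k≢l = ℕ.<⇒≢ (ℕ.n<1+n k)
  k∉P : movable k ∉ P
  k∉P = fresh-∉ P ℕ.≤-refl
  l∉P : movable l ∉ P
  l∉P = fresh-∉ P (ℕ.n≤1+n k)
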